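{- For every integer $n\ge1$, in the free group $F_2$ on $a,b$ one has \[(ab)^n=\prod_{i=1}^{n-1}\Big(\prod_{j=0}^{i-1}[a^ib^{i-1-j},T^{ -1}]\,T^{ -1}\Big)\cdot a^nb^n,\] where $T=[a,b]$ and both products are taken in increasing order of the index from left to right (the empty product being $1$).
   Context: $[x,y]=xyx^{ -1}y^{ -1}$. -}

module Defs where

open import Data.Nat using (ℕ; zero; suc; _∸_)
open import Data.Bool using (Bool; true; false; not)
open import Data.List using (List; []; _∷_; foldr; reverse; map)
open import Data.Product using (_×_; _,_)

-- The free group F₂ on the generators a, b, realised concretely as
-- freely reduced words (normal forms).  Group equality is _≡_ on reduced words.

data Gen : Set where
  ga gb : Gen

-- a letter is a generator together with an exponent sign (true = +1, false = -1)
Letter : Set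
Letter = Gen × Bool

invPair : Letter → Letter → Bool
invPair (ga , s) (ga , t) = not-eq s t
  where
  not-eq : Bool → Bool → Bool
  not-eq true false = true
  not-eq false true = true
  not-eq _ _ = false
invPair (gb , s) (gb , t) = not-eq s t
  where
  not-eq : Bool → Bool → Bool
  not-eq true false = true
  not-eq false true = true
  not-eq _ _ = false
invPair _ _ = false

push : Letter → List Letter → List Letter
push l [] = l ∷ []
push l (m ∷ w) with invPair l m
... | true  = w
... | false = l ∷ m ∷ w

F₂ : Set
F₂ = List Letter

infixl 7 _·_
_·_ : F₂ → F₂ → F₂
x · y = foldr push y x

e : F₂
e = []

invL : Letter → Letter
invL (g , s) = (g , not s)

_⁻¹ : F₂ → F₂
x ⁻¹ = reverse (map invL x)

a : F₂
a = (ga , true) ∷ []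

b : F₂
b = (gb , true) ∷ []

_^_ : F₂ → ℕ → F₂
x ^ zero = e
x ^ suc n = x · (x ^ n)

⟦_,_⟧ : F₂ → F₂ → F₂
⟦ x , y ⟧ = x · y · (x ⁻¹) · (y ⁻¹)

prod : ℕ → (ℕ → F₂) → F₂
prod zero f = e
prod (suc k) f = prod k f · f k

T : F₂
T = ⟦ a , b ⟧

{-# OPTIONS --safe #-}
-- The identity holds in every group, so it suffices to make the reduced words F₂ a group.
-- Put t = T⁻¹ = (b a)(a b)⁻¹.  Since [w, t] t = w t w⁻¹, the factor with w = aⁱ bⁱ⁻¹⁻ʲ equals
-- (w b a)(w a b)⁻¹ = ℓⱼ ℓⱼ₊₁⁻¹ for ℓⱼ = aⁱ bⁱ⁻ʲ a bʲ, so the inner product telescopes to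
-- ℓ₀ ℓᵢ⁻¹ = aⁱ bⁱ a (aⁱ⁺¹ bⁱ)⁻¹.  Hence the i-th row times aⁱ⁺¹ bⁱ⁺¹ is aⁱ bⁱ · a b, which is
-- exactly the step (a b)ⁱ⁺¹ = (a b)ⁱ · a b of an induction on n.
module Submission where

open import Algebra.Bundles using (Group)
open import Data.Nat using (ℕ; zero; suc; _+_; _∸_; _≤_; _<_; s≤s⁻¹)
open import Data.Nat.Properties using (+-comm; +-∸-assoc; n∸n≡0; ≤-refl; m<n⇒m<1+n)
open import Relation.Binary.PropositionalEquality as ≡ using (_≡_)

module PowerOfProduct {c ℓ} (G : Group c ℓ) where

  open Group G
  open import Algebra.Properties.Group G
    using (⁻¹-anti-homo-∙; ⁻¹-anti-homo-//; //-rightDividesˡ; \\-leftDividesˡ; //-cong₂)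
  open import Algebra.Properties.Semigroup semigroup using ([uv∙w]x≈u[vw∙x])
  open import Algebra.Properties.Monoid.Mult monoid using (_×_; ×-homo-+; ×-homo-1; ×-congˡ)
  open import Relation.Binary.Reasoning.Setoid setoid

  prod : ℕ → (ℕ → Carrier) → Carrier
  prod zero    f = ε
  prod (suc k) f = prod k f ∙ f k

  commutator : Carrier → Carrier → Carrier
  commutator x y = x ∙ y ∙ x ⁻¹ ∙ y ⁻¹

  ×-sucʳ : ∀ x n → suc n × x ≈ n × x ∙ x
  ×-sucʳ x n = begin
    suc n × x      ≈⟨ ×-congˡ (+-comm 1 n) ⟩
    (n + 1) × x    ≈⟨ ×-homo-+ x n 1 ⟩
    n × x ∙ 1 × x  ≈⟨ ∙-congˡ (×-homo-1 x) ⟩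
    n × x ∙ x      ∎

  //-∙-cancel : ∀ x y z → (x // y) ∙ (y ∙ z) ≈ x ∙ z
  //-∙-cancel x y z = begin
    (x // y) ∙ (y ∙ z)  ≈⟨ assoc (x // y) y z ⟨
    (x // y) ∙ y ∙ z    ≈⟨ ∙-congʳ (//-rightDividesˡ y x) ⟩
    x ∙ z               ∎

  ∙-//-∙-cancelʳ : ∀ x y z → x ∙ z // (y ∙ z) ≈ x // y
  ∙-//-∙-cancelʳ x y z = begin
    x ∙ z ∙ (y ∙ z) ⁻¹      ≈⟨ ∙-congˡ (⁻¹-anti-homo-∙ y z) ⟩
    x ∙ z ∙ (z ⁻¹ ∙ y ⁻¹)   ≈⟨ assoc x z _ ⟩
    x ∙ (z ∙ (z ⁻¹ ∙ y ⁻¹)) ≈⟨ ∙-congˡ (\\-leftDividesˡ z (y ⁻¹)) ⟩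
    x // y                  ∎

  ∙-//-conjugate : ∀ w x y → w ∙ (x // y) // w ≈ w ∙ x // (w ∙ y)
  ∙-//-conjugate w x y = begin
    w ∙ (x ∙ y ⁻¹) ∙ w ⁻¹   ≈⟨ ∙-congʳ (assoc w x (y ⁻¹)) ⟨
    w ∙ x ∙ y ⁻¹ ∙ w ⁻¹     ≈⟨ assoc (w ∙ x) (y ⁻¹) (w ⁻¹) ⟩
    w ∙ x ∙ (y ⁻¹ ∙ w ⁻¹)   ≈⟨ ∙-congˡ (⁻¹-anti-homo-∙ w y) ⟨
    w ∙ x // (w ∙ y)        ∎

  commutator-∙ʳ : ∀ x y → commutator x y ∙ y ≈ x ∙ y // x
  commutator-∙ʳ x y = //-rightDividesˡ y (x ∙ y // x)

  commutator-⁻¹ : ∀ x y → commutator x y ⁻¹ ≈ y ∙ x // (x ∙ y)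
  commutator-⁻¹ x y = begin
    commutator x y ⁻¹         ≈⟨ ⁻¹-cong commutator≈ ⟩
    (x ∙ y // (y ∙ x)) ⁻¹     ≈⟨ ⁻¹-anti-homo-// (x ∙ y) (y ∙ x) ⟩
    y ∙ x // (x ∙ y)          ∎
    where
    commutator≈ : commutator x y ≈ x ∙ y // (y ∙ x)
    commutator≈ = begin
      x ∙ y ∙ x ⁻¹ ∙ y ⁻¹     ≈⟨ assoc (x ∙ y) (x ⁻¹) (y ⁻¹) ⟩
      x ∙ y ∙ (x ⁻¹ ∙ y ⁻¹)   ≈⟨ ∙-congˡ (⁻¹-anti-homo-∙ y x) ⟨
      x ∙ y // (y ∙ x)        ∎

  prod-cong : ∀ n {f g : ℕ → Carrier} → (∀ {i} → i < n → f i ≈ g i) → prod n f ≈ prod n g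
  prod-cong zero    f≈g = refl
  prod-cong (suc n) f≈g = ∙-cong (prod-cong n (λ i<n → f≈g (m<n⇒m<1+n i<n))) (f≈g ≤-refl)

  prod-telescope : ∀ n (f : ℕ → Carrier) → prod n (λ i → f i // f (suc i)) ≈ f 0 // f n
  prod-telescope zero    f = sym (inverseʳ (f 0))
  prod-telescope (suc n) f = begin
    prod n (λ i → f i // f (suc i)) ∙ (f n // f (suc n)) ≈⟨ ∙-congʳ (prod-telescope n f) ⟩
    (f 0 // f n) ∙ (f n // f (suc n))                    ≈⟨ //-∙-cancel (f 0) (f n) _ ⟩
    f 0 // f (suc n)                                     ∎

  module _ (x y : Carrier) where

    factor : ℕ → ℕ → Carrier
    factor i j = commutator (suc i × x ∙ (i ∸ j) × y) (commutator x y ⁻¹) ∙ commutator x y ⁻¹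

    row : ℕ → Carrier
    row i = prod (suc i) (factor i)

    -- ℓⱼ of the row with outer index suc i
    ladder : ℕ → ℕ → Carrier
    ladder i j = suc i × x ∙ (suc i ∸ j) × y ∙ x ∙ j × y

    factor-telescopes : ∀ i {j} → j ≤ i → factor i j ≈ ladder i j // ladder i (suc j)
    factor-telescopes i {j} j≤i = begin
      factor i j                                  ≈⟨ commutator-∙ʳ w t ⟩
      w ∙ t // w                                  ≈⟨ ∙-congʳ (∙-congˡ (commutator-⁻¹ x y)) ⟩
      w ∙ (y ∙ x // (x ∙ y)) // w                 ≈⟨ ∙-//-conjugate w (y ∙ x) (x ∙ y) ⟩
      w ∙ (y ∙ x) // (w ∙ (x ∙ y))                ≈⟨ //-cong₂ numerator (assoc w x y) ⟨
      X ∙ (suc i ∸ j) × y ∙ x // (w ∙ x ∙ y)      ≈⟨ ∙-//-∙-cancelʳ _ _ (j × y) ⟨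
      ladder i j // (w ∙ x ∙ y ∙ j × y)           ≈⟨ //-cong₂ refl (assoc (w ∙ x) y (j × y)) ⟩
      ladder i j // ladder i (suc j)              ∎
      where
      t = commutator x y ⁻¹
      X = suc i × x
      w = X ∙ (i ∸ j) × y
      numerator : X ∙ (suc i ∸ j) × y ∙ x ≈ w ∙ (y ∙ x)
      numerator = begin
        X ∙ (suc i ∸ j) × y ∙ x       ≡⟨ ≡.cong (λ m → X ∙ m × y ∙ x) (+-∸-assoc 1 j≤i) ⟩
        X ∙ suc (i ∸ j) × y ∙ x       ≈⟨ ∙-congʳ (∙-congˡ (×-sucʳ y (i ∸ j))) ⟩
        X ∙ ((i ∸ j) × y ∙ y) ∙ x     ≈⟨ ∙-congʳ (assoc X _ y) ⟨
        w ∙ y ∙ x                     ≈⟨ assoc w y x ⟩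
        w ∙ (y ∙ x)                   ∎

    row-telescopes : ∀ i → row i ≈ ladder i 0 // ladder i (suc i)
    row-telescopes i = begin
      prod (suc i) (factor i)                                   ≈⟨ prod-cong (suc i) (λ j<1+i → factor-telescopes i (s≤s⁻¹ j<1+i)) ⟩
      prod (suc i) (λ j → ladder i j // ladder i (suc j))       ≈⟨ prod-telescope (suc i) (ladder i) ⟩
      ladder i 0 // ladder i (suc i)                            ∎

    ladder-first : ∀ i → ladder i 0 ∙ y ≈ suc i × x ∙ suc i × y ∙ (x ∙ y)
    ladder-first i = begin
      suc i × x ∙ suc i × y ∙ x ∙ ε ∙ y     ≈⟨ ∙-congʳ (identityʳ _) ⟩
      suc i × x ∙ suc i × y ∙ x ∙ y         ≈⟨ assoc _ x y ⟩
      suc i × x ∙ suc i × y ∙ (x ∙ y)       ∎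

    ladder-last : ∀ i → ladder i (suc i) ∙ y ≈ suc (suc i) × x ∙ suc (suc i) × y
    ladder-last i = begin
      suc i × x ∙ (i ∸ i) × y ∙ x ∙ suc i × y ∙ y   ≡⟨ ≡.cong (λ m → suc i × x ∙ m × y ∙ x ∙ suc i × y ∙ y) (n∸n≡0 i) ⟩
      suc i × x ∙ ε ∙ x ∙ suc i × y ∙ y             ≈⟨ ∙-congʳ (∙-congʳ (∙-congʳ (identityʳ _))) ⟩
      suc i × x ∙ x ∙ suc i × y ∙ y                 ≈⟨ assoc _ (suc i × y) y ⟩
      suc i × x ∙ x ∙ (suc i × y ∙ y)               ≈⟨ ∙-cong (×-sucʳ x (suc i)) (×-sucʳ y (suc i)) ⟨
      suc (suc i) × x ∙ suc (suc i) × y             ∎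

    row-step : ∀ i → row i ∙ suc (suc i) × x ∙ suc (suc i) × y ≈ suc i × x ∙ suc i × y ∙ (x ∙ y)
    row-step i = begin
      row i ∙ suc (suc i) × x ∙ suc (suc i) × y                 ≈⟨ assoc (row i) _ _ ⟩
      row i ∙ (suc (suc i) × x ∙ suc (suc i) × y)               ≈⟨ ∙-cong (row-telescopes i) (sym (ladder-last i)) ⟩
      (ladder i 0 // ladder i (suc i)) ∙ (ladder i (suc i) ∙ y) ≈⟨ //-∙-cancel _ (ladder i (suc i)) y ⟩
      ladder i 0 ∙ y                                            ≈⟨ ladder-first i ⟩
      suc i × x ∙ suc i × y ∙ (x ∙ y)                           ∎

    power-of-product : ∀ k → suc k × (x ∙ y) ≈ prod k row ∙ suc k × x ∙ suc k × y
    power-of-product zero = begin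
      1 × (x ∙ y)        ≈⟨ ×-homo-1 (x ∙ y) ⟩
      x ∙ y              ≈⟨ ∙-congʳ (identityˡ x) ⟨
      ε ∙ x ∙ y          ≈⟨ ∙-cong (∙-congˡ (×-homo-1 x)) (×-homo-1 y) ⟨
      ε ∙ 1 × x ∙ 1 × y  ∎
    power-of-product (suc k) = begin
      suc (suc k) × (x ∙ y)                                         ≈⟨ ×-sucʳ (x ∙ y) (suc k) ⟩
      suc k × (x ∙ y) ∙ (x ∙ y)                                     ≈⟨ ∙-congʳ (power-of-product k) ⟩
      prod k row ∙ suc k × x ∙ suc k × y ∙ (x ∙ y)                  ≈⟨ [uv∙w]x≈u[vw∙x] _ _ _ _ ⟩
      prod k row ∙ (suc k × x ∙ suc k × y ∙ (x ∙ y))                ≈⟨ ∙-congˡ (row-step k) ⟨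
      prod k row ∙ (row k ∙ suc (suc k) × x ∙ suc (suc k) × y)      ≈⟨ [uv∙w]x≈u[vw∙x] _ _ _ _ ⟨
      prod k row ∙ row k ∙ suc (suc k) × x ∙ suc (suc k) × y        ∎

open import Data.Bool using (true; false)
open import Data.Bool.Properties using (not-involutive)
open import Data.List using ([]; _∷_; map; reverse; reverseAcc)
open import Data.List.Properties using (foldr-++; unfold-reverse)
open import Data.List.Relation.Unary.Linked as Linked using (Linked; []; [-]; _∷_)
open import Data.List.Relation.Unary.Linked.Properties using (map⁺)
open import Data.Product using (Σ; _,_; proj₁)
open import Function using (flip; _on_)
open import Level using (0ℓ)
open import Relation.Binary.Core using (Rel)
import Relation.Binary.Construct.On as On
open import Relation.Binary.PropositionalEquality
open import Defs

reverse⁺ : ∀ {a ℓ} {A : Set a} {R : Rel A ℓ} {xs} → Linked R xs → Linked (flip R) (reverse xs)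
reverse⁺ []                 = []
reverse⁺ {R = R} {x ∷ _} links = onto links [-]
  where
  onto : ∀ {x xs acc} → Linked R (x ∷ xs) → Linked (flip R) (x ∷ acc) → Linked (flip R) (reverseAcc (x ∷ acc) xs)
  onto [-]         acc = acc
  onto (Rxy ∷ Rys) acc = onto Rys (Rxy ∷ acc)

Reduced : F₂ → Set
Reduced = Linked (λ l m → invPair l m ≡ false)

invL-involutive : ∀ l → invL (invL l) ≡ l
invL-involutive (g , s) = cong (g ,_) (not-involutive s)

invPair-invL : ∀ l → invPair l (invL l) ≡ true
invPair-invL (ga , true)  = refl
invPair-invL (ga , false) = refl
invPair-invL (gb , true)  = refl
invPair-invL (gb , false) = refl

invPair⇒≡invL : ∀ l m → invPair l m ≡ true → m ≡ invL l
invPair⇒≡invL (ga , true)  (ga , false) _ = refl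
invPair⇒≡invL (ga , false) (ga , true)  _ = refl
invPair⇒≡invL (gb , true)  (gb , false) _ = refl
invPair⇒≡invL (gb , false) (gb , true)  _ = refl
invPair⇒≡invL (ga , true)  (ga , true)  ()
invPair⇒≡invL (ga , false) (ga , false) ()
invPair⇒≡invL (gb , true)  (gb , true)  ()
invPair⇒≡invL (gb , false) (gb , false) ()
invPair⇒≡invL (ga , _)     (gb , _)     ()
invPair⇒≡invL (gb , _)     (ga , _)     ()

invPair-flip : ∀ l m → invPair (invL m) (invL l) ≡ invPair l m
invPair-flip (ga , true)  (ga , true)  = refl
invPair-flip (ga , true)  (ga , false) = refl
invPair-flip (ga , false) (ga , true)  = refl
invPair-flip (ga , false) (ga , false) = refl
invPair-flip (gb , true)  (gb , true)  = refl
invPair-flip (gb , true)  (gb , false) = refl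
invPair-flip (gb , false) (gb , true)  = refl
invPair-flip (gb , false) (gb , false) = refl
invPair-flip (ga , _)     (gb , _)     = refl
invPair-flip (gb , _)     (ga , _)     = refl

invPair-trans : ∀ l m n → invPair l m ≡ true → invPair m n ≡ true → l ≡ n
invPair-trans l m n lm mn = begin
  l               ≡⟨ invL-involutive l ⟨
  invL (invL l)   ≡⟨ cong invL (invPair⇒≡invL l m lm) ⟨
  invL m          ≡⟨ invPair⇒≡invL m n mn ⟨
  n               ∎
  where open ≡-Reasoning

push-reduced : ∀ l {w} → Reduced w → Reduced (push l w)
push-reduced l []        = [-]
push-reduced l {m ∷ w} r with invPair l m in lm
... | true  = Linked.tail r
... | false = lm ∷ r

push-∷ : ∀ {l w} → Reduced (l ∷ w) → push l w ≡ l ∷ w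
push-∷ [-]                 = refl
push-∷ (lm ∷ _) rewrite lm = refl

push-cancel : ∀ {l m w} → invPair l m ≡ true → Reduced w → push l (push m w) ≡ w
push-cancel lm [] rewrite lm = refl
push-cancel {l} {m} {n ∷ _} lm r with invPair m n in mn
... | true  with refl ← invPair-trans l m n lm mn = push-∷ r
... | false rewrite lm = refl

·-reduced : ∀ x {y} → Reduced y → Reduced (x · y)
·-reduced []      r = r
·-reduced (l ∷ x) r = push-reduced l (·-reduced x r)

push-· : ∀ l {w z} → Reduced w → Reduced z → push l w · z ≡ push l (w · z)
push-· l []               _  = refl
push-· l {m ∷ w} {z} rw rz with invPair l m in lm
... | true  = sym (push-cancel lm (·-reduced w rz))
... | false = refl

·-assoc : ∀ x {y z} → Reduced y → Reduced z → x · y · z ≡ x · (y · z)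
·-assoc []      ry rz = refl
·-assoc (l ∷ x) ry rz = trans (push-· l (·-reduced x ry) rz) (cong (push l) (·-assoc x ry rz))

·-identityʳ : ∀ {x} → Reduced x → x · e ≡ x
·-identityʳ []               = refl
·-identityʳ [-]              = refl
·-identityʳ {l ∷ _} (lm ∷ r) = trans (cong (push l) (·-identityʳ r)) (push-∷ (lm ∷ r))

⁻¹-∷-· : ∀ l x y → (l ∷ x) ⁻¹ · y ≡ x ⁻¹ · push (invL l) y
⁻¹-∷-· l x y = trans (cong (_· y) (unfold-reverse (invL l) (map invL x)))
                      (foldr-++ push y (reverse (map invL x)) (invL l ∷ []))

·-inverseˡ : ∀ x {y} → Reduced y → x ⁻¹ · (x · y) ≡ y
·-inverseˡ []      r = refl
·-inverseˡ (l ∷ x) {y} r = begin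
  (l ∷ x) ⁻¹ · push l (x · y)           ≡⟨ ⁻¹-∷-· l x _ ⟩
  x ⁻¹ · push (invL l) (push l (x · y)) ≡⟨ cong (x ⁻¹ ·_) (push-cancel invPair-invLˡ (·-reduced x r)) ⟩
  x ⁻¹ · (x · y)                        ≡⟨ ·-inverseˡ x r ⟩
  y                                     ∎
  where
  open ≡-Reasoning
  invPair-invLˡ : invPair (invL l) l ≡ true
  invPair-invLˡ = subst (λ m → invPair (invL l) m ≡ true) (invL-involutive l) (invPair-invL (invL l))

·-inverseʳ : ∀ x {y} → Reduced y → x · (x ⁻¹ · y) ≡ y
·-inverseʳ []      r = refl
·-inverseʳ (l ∷ x) {y} r = begin
  push l (x · ((l ∷ x) ⁻¹ · y))         ≡⟨ cong (λ w → push l (x · w)) (⁻¹-∷-· l x y) ⟩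
  push l (x · (x ⁻¹ · push (invL l) y)) ≡⟨ cong (push l) (·-inverseʳ x (push-reduced (invL l) r)) ⟩
  push l (push (invL l) y)              ≡⟨ push-cancel (invPair-invL l) r ⟩
  y                                     ∎
  where open ≡-Reasoning

⁻¹-reduced : ∀ {x} → Reduced x → Reduced (x ⁻¹)
⁻¹-reduced r = reverse⁺ (map⁺ (Linked.map (λ {l} {m} lm → trans (invPair-flip l m) lm) r))

ReducedWord : Set
ReducedWord = Σ F₂ Reduced

F₂-group : Group 0ℓ 0ℓ
F₂-group = record
  { Carrier = ReducedWord
  ; _≈_     = _≡_ on proj₁
  ; _∙_     = λ (x , _) (y , ry) → x · y , ·-reduced x ry
  ; ε       = e , []
  ; _⁻¹     = λ (x , rx) → x ⁻¹ , ⁻¹-reduced rx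
  ; isGroup = record
    { isMonoid = record
      { isSemigroup = record
        { isMagma = record
          { isEquivalence = On.isEquivalence proj₁ isEquivalence
          ; ∙-cong        = cong₂ _·_
          }
        ; assoc = λ (x , _) (_ , ry) (_ , rz) → ·-assoc x ry rz
        }
      ; identity = (λ _ → refl) , (λ (_ , rx) → ·-identityʳ rx)
      }
    ; inverse = (λ (x , rx) → trans (cong (x ⁻¹ ·_) (sym (·-identityʳ rx))) (·-inverseˡ x []))
              , (λ (x , rx) → trans (cong (x ·_) (sym (·-identityʳ (⁻¹-reduced rx)))) (·-inverseʳ x []))
    ; ⁻¹-cong = cong _⁻¹
    }
  }

open Group F₂-group using (_∙_)
open import Algebra.Properties.Monoid.Mult (Group.monoid F₂-group) using (_×_)
module InF₂ = PowerOfProduct F₂-group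

word-× : ∀ (x : ReducedWord) n → proj₁ (n × x) ≡ proj₁ x ^ n
word-× x zero    = refl
word-× x (suc n) = cong (proj₁ x ·_) (word-× x n)

word-prod : ∀ k {f : ℕ → ReducedWord} {g : ℕ → F₂} → (∀ i → proj₁ (f i) ≡ g i) → proj₁ (InF₂.prod k f) ≡ prod k g
word-prod zero    _   = refl
word-prod (suc k) f≡g = cong₂ _·_ (word-prod k f≡g) (f≡g k)

gen-a gen-b : ReducedWord
gen-a = a , [-]
gen-b = b , [-]

lemma2p13 : (n : ℕ) → 1 ≤ n →
    (a · b) ^ n ≡
      prod (n ∸ 1) (λ k → prod (suc k) (λ j → ⟦ (a ^ suc k) · (b ^ (suc k ∸ 1 ∸ j)) , T ⁻¹ ⟧ · (T ⁻¹)))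
        · (a ^ n) · (b ^ n)
lemma2p13 (suc k) _ = begin
  (a · b) ^ suc k                  ≡⟨ word-× (gen-a ∙ gen-b) (suc k) ⟨
  proj₁ (suc k × (gen-a ∙ gen-b))  ≡⟨ InF₂.power-of-product gen-a gen-b k ⟩
  proj₁ (InF₂.prod k (InF₂.row gen-a gen-b)) · proj₁ (suc k × gen-a) · proj₁ (suc k × gen-b)
    ≡⟨ cong₂ _·_ (cong₂ _·_ (word-prod k word-row) (word-× gen-a (suc k))) (word-× gen-b (suc k)) ⟩
  _                                ∎
  where
  open ≡-Reasoning
  word-row : ∀ i → proj₁ (InF₂.row gen-a gen-b i) ≡ prod (suc i) (λ j → ⟦ a ^ suc i · b ^ (i ∸ j) , T ⁻¹ ⟧ · T ⁻¹)
  word-row i = word-prod (suc i) (λ j →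
    cong (λ w → ⟦ w , T ⁻¹ ⟧ · T ⁻¹) (cong₂ _·_ (word-× gen-a (suc i)) (word-× gen-b (i ∸ j))))
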